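{- Let $T$ be an irreducible two-way-comparison decision tree for an instance $(Q,w,\mathcal C,K)$, let $u$ be a node of $T$, let $x$ be any allowed test (not necessarily in $T$), let $u=u_1\to u_2\to\cdots\to u_d$ be the $x$-consistent path from $u$, and let $T'_x$ be the result of splitting $T_u$ around $x$, with yes-subtree $T^{\mathsf{yes}}_u$ and no-subtree $T^{\mathsf{no}}_u$ of its root $x$. Then: (i) For each $i\in\{1,\dots,d-1\}$, the outcome $u_i\to u_{i+1}'$ is inconsistent with exactly one outcome $\alpha\in\{\mathsf{yes},\mathsf{no}\}$ at $x$; for this $\alpha$, node $u_i$ and the subtree $T_{u_{i+1}'}$ are deleted from $T^\alpha_u$ and are not deleted from the other subtree $T^{\alpha'}_u$, where $\alpha'$ is the outcome opposite to $\alpha$. (ii) If $u_d$ is a test node, then one outcome at $u_d$, say $u_d\to y$, is inconsistent with the yes-outcome at $x$, while the other outcome $u_d\to y'$ is inconsistent with the no-outcome at $x$; within $T^{\mathsf{yes}}_u$ node $u_d$ and subtree $T_y$ are deleted, while within $T^{\mathsf{no}}_u$ node $u_d$ and subtree $T_{y'}$ are deleted. (iii) For each leaf $z$ of $T_u$ other than $u_d$ (in case $u_d$ is a leaf), only one of the two copies of $z$ remains in $T'_x$, and the query set of the remaining copy in $T'_x$ (the set of queries of $Q_u$ whose search in $T'_x$ reaches it) equals the query set of $z$ in $T_u$.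
   Context: An instance $(Q,w,\mathcal C,K)$ consists of a totally ordered finite set $Q$ of queries with weights $w(q)\ge0$, a collection $\mathcal C\subseteq 2^Q$ of classes, and a set $K\subseteq Q$ of keys; every query belongs to some class. An allowed test is "$q<k$" for some $k\in K$ with $\min Q<k\le\max Q$, or "$q=k$" for some $k\in K$. A two-way-comparison decision tree is a rooted binary tree whose non-leaf nodes are allowed tests, with children labeled by the outcomes yes/no, and whose leaves are labeled by classes, each leaf's class containing every query whose search ends there. The search for $q$ starts at the root and moves to the yes-child if $q$ satisfies the test and to the no-child otherwise; $q$ reaches every node on its search path. $Q_u$ is the set of queries reaching node $u$. The tree is irreducible if for every node $u$, at least one query reaches $u$, and if some class contains all of $Q_u$ then $u$ is a leaf. An edge $u\to v$ to a child is identified with the corresponding outcome at $u$. Two outcomes are consistent if some query in $Q$ satisfies both, otherwise inconsistent. Two tests are equivalent if either they give the same outcome for every $q\in Q$ or opposite outcomes for every $q\in Q$. $T_u$ denotes the subtree of $T$ rooted at $u$. For a downward path $u_1\to u_2\to\cdots$, $u_i'$ denotes the sibling of $u_i$. The $x$-consistent path from $u$ is the maximal downward path from $u$ in $T_u$ such that each outcome along it is consistent with both outcomes at $x$. Splitting $T_u$ around $x$: let $u=u_1\to\cdots\to u_d$ be the $x$-consistent path from $u$. Initialize $T'_x$ to have root $x$ whose yes- and no-subtrees, $T^{\mathsf{yes}}_u$ and $T^{\mathsf{no}}_u$, are each a copy of $T_u$. For each outcome $\alpha\in\{\mathsf{yes},\mathsf{no}\}$ at $x$, modify $T^{\alpha}_u$: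 for each $i\in\{1,\dots,d-1\}$, if the outcome $u_i\to u_{i+1}'$ is inconsistent with the $\alpha$-outcome at $x$, delete (within $T^\alpha_u$) node $u_i$ and the subtree rooted at $u_{i+1}'$, making $u_{i+1}$ the child of $u_i$'s current parent in place of $u_i$. For $i=d$: if $u_d$ is a leaf, stop; otherwise let $u_d\to y'$ be the outcome at $u_d$ inconsistent with the $\alpha$-outcome at $x$, and delete (within $T^\alpha_u$) node $u_d$ and the subtree rooted at $y'$, making the other child $y$ of $u_d$ the child of $u_d$'s current parent in place of $u_d$. -}

module Defs where

open import Data.Nat using (ℕ; zero; suc; _<ᵇ_; _≡ᵇ_; _<_)
open import Data.Fin using (Fin; toℕ)
open import Data.Fin.Subset using (Subset; _∈_)
open import Data.Fin.Properties using (any?)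
open import Data.Bool using (Bool; true; false; if_then_else_; not)
open import Data.Bool.Properties using () renaming (_≟_ to _≟ᵇ_)
open import Data.List using (List; []; _∷_; _++_; [_])
open import Data.Maybe using (Maybe; just; nothing)
open import Data.Product using (Σ; ∃; ∃-syntax; ∃₂; _×_; _,_)
open import Data.Unit using (⊤)
open import Data.Empty using (⊥)
open import Relation.Nullary using (Dec; yes; no; does; ¬_)
open import Relation.Nullary.Decidable using (_×-dec_)
open import Relation.Binary.PropositionalEquality using (_≡_)

-- Instances.  Queries Q = Fin n with its natural total order.
-- Classes are an indexed family  class : Fin c → Subset n.
-- (Weights play no role in the statement and are omitted.)

record Instance (n c : ℕ) : Set where
  field
    class  : Fin c → Subset n
    keys   : Subset n
    covers : ∀ (q : Fin n) → ∃[ j ] q ∈ class j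

data Test (n : ℕ) : Set where
  lt : Fin n → Test n
  eq : Fin n → Test n

eval : ∀ {n} → Test n → Fin n → Bool
eval (lt k) q = toℕ q <ᵇ toℕ k
eval (eq k) q = toℕ q ≡ᵇ toℕ k

-- allowed tests: k ∈ K, and for "q < k" also min Q < k ≤ max Q
Allowed : ∀ {n c} → Instance n c → Test n → Set
Allowed I (lt k) = k ∈ Instance.keys I × 0 < toℕ k
Allowed I (eq k) = k ∈ Instance.keys I

Outcome : ℕ → Set
Outcome n = Test n × Bool

Consistent : ∀ {n} → Outcome n → Outcome n → Set
Consistent {n} (t , b) (t' , b') = ∃[ q ] (eval t q ≡ b × eval t' q ≡ b')

consistent? : ∀ {n} (o o' : Outcome n) → Dec (Consistent o o')
consistent? (t , b) (t' , b') = any? (λ q → (eval t q ≟ᵇ b) ×-dec (eval t' q ≟ᵇ b'))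

ConsistentBoth : ∀ {n} → Test n → Outcome n → Set
ConsistentBoth x o = Consistent o (x , true) × Consistent o (x , false)

consistentBoth? : ∀ {n} (x : Test n) (o : Outcome n) → Dec (ConsistentBoth x o)
consistentBoth? x o = consistent? o (x , true) ×-dec consistent? o (x , false)

-- Every node carries a label of type A (used to
-- identify copies of nodes); leaves carry a class index, internal
-- nodes carry a test, a yes-subtree and a no-subtree (in this order).

data Tree (n c : ℕ) (A : Set) : Set where
  leaf : A → Fin c → Tree n c A
  node : A → Test n → Tree n c A → Tree n c A → Tree n c A

-- positions of nodes: the list of outcomes from the root (true = yes)
Pos : Set
Pos = List Bool

module _ {n c : ℕ} {A : Set} where

  label : Tree n c A → A
  label (leaf a _)     = a
  label (node a _ _ _) = a

  _at_ : Tree n c A → Pos → Maybe (Tree n c A)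
  T at [] = just T
  leaf _ _ at (_ ∷ _) = nothing
  node _ _ Y N at (true ∷ p)  = Y at p
  node _ _ Y N at (false ∷ p) = N at p

  labelAt : Tree n c A → Pos → Maybe A
  labelAt T p with T at p
  ... | just S  = just (label S)
  ... | nothing = nothing

  testAt : Tree n c A → Pos → Maybe (Test n)
  testAt T p with T at p
  ... | just (node _ t _ _) = just t
  ... | just (leaf _ _)     = nothing
  ... | nothing             = nothing

  IsNode : Tree n c A → Pos → Set
  IsNode T p = ∃[ S ] T at p ≡ just S

  IsLeaf : Tree n c A → Set
  IsLeaf (leaf _ _)     = ⊤
  IsLeaf (node _ _ _ _) = ⊥

  LeafAt : Tree n c A → Pos → Set
  LeafAt T p = ∃₂ λ a j → T at p ≡ just (leaf a j)

  Reaches : Tree n c A → Pos → Fin n → Set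
  Reaches T [] q = ⊤
  Reaches (leaf _ _) (_ ∷ _) q = ⊥
  Reaches (node _ t Y N) (true ∷ p) q  = eval t q ≡ true × Reaches Y p q
  Reaches (node _ t Y N) (false ∷ p) q = eval t q ≡ false × Reaches N p q

  IsDecisionTree : Instance n c → Tree n c A → Set
  IsDecisionTree I T =
    (∀ p a t Y N → T at p ≡ just (node a t Y N) → Allowed I t) ×
    (∀ p a j → T at p ≡ just (leaf a j) →
       ∀ q → Reaches T p q → q ∈ Instance.class I j)

  Irreducible : Instance n c → Tree n c A → Set
  Irreducible I T =
    ∀ p S → T at p ≡ just S →
      (∃[ q ] Reaches T p q) ×
      ((∃[ j ] (∀ q → Reaches T p q → q ∈ Instance.class I j)) → IsLeaf S)

  annotFrom : Pos → Tree n c A → Tree n c (Maybe Pos)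
  annotFrom p (leaf _ j)     = leaf (just p) j
  annotFrom p (node _ t Y N) =
    node (just p) t (annotFrom (p ++ [ true ]) Y) (annotFrom (p ++ [ false ]) N)

  annot : Tree n c A → Tree n c (Maybe Pos)
  annot = annotFrom []

  -- the x-consistent path from the root, as its list of outcomes
  -- u₁ → u₂ → ⋯ → u_d  (so d = length + 1)
  xPath : Test n → Tree n c A → Pos
  xPath x (leaf _ _) = []
  xPath x (node _ t Y N) =
    if does (consistentBoth? x (t , true)) then true ∷ xPath x Y
    else if does (consistentBoth? x (t , false)) then false ∷ xPath x N
    else []

  -- T^α : the copy of the tree modified for outcome α at x, following
  -- the x-consistent path (deleting u_i and T_{u'_{i+1}} when the outcome
  -- u_i → u'_{i+1} is inconsistent with α at x; at a test node u_d
  -- deleting u_d and the subtree T_{y'} whose outcome u_d → y' is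
  -- inconsistent with α at x).
  splitSide : Test n → Bool → Tree n c A → Tree n c A
  splitSide x α (leaf a j) = leaf a j
  splitSide x α (node a t Y N) =
    if does (consistentBoth? x (t , true)) then
      (if does (consistent? (t , false) (x , α))
         then node a t (splitSide x α Y) N
         else splitSide x α Y)
    else if does (consistentBoth? x (t , false)) then
      (if does (consistent? (t , true) (x , α))
         then node a t Y (splitSide x α N)
         else splitSide x α N)
    else
      (if does (consistent? (t , true) (x , α)) then Y else N)

sideTree : ∀ {n c A} → Test n → Bool → Tree n c A → Tree n c (Maybe Pos)
sideTree x α Tu = splitSide x α (annot Tu)

splitAround : ∀ {n c A} → Test n → Tree n c A → Tree n c (Maybe Pos)
splitAround x Tu = node nothing x (sideTree x true Tu) (sideTree x false Tu)

HasCopy : ∀ {n c} → Tree n c (Maybe Pos) → Pos → Set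
HasCopy D z = ∃[ p ] labelAt D p ≡ just (just z)

-- Label every node of T_u by its position, so that a copy of a node in T'_x is a node carrying its
-- label.  The only property of tests that is used is that two tests on a totally ordered set never
-- realise all four combinations of outcomes.  Hence at a node u_i of the x-consistent path the
-- sibling outcome is inconsistent with exactly one outcome α of x, and only T^α_u loses u_i and the
-- sibling subtree, while at u_d each outcome of x keeps exactly one child; these facts are carried
-- down the path as statements about which labels occur.  A leaf z off the path is thus deleted from
-- one side and kept on the side of the queries reaching it; there every deleted node has lost a
-- branch those queries never take, so they reach the copy of z exactly when they reach z.

module Submission where

open import Defs
open import Data.Nat using (ℕ; zero; suc; _<_; _≤_; _<ᵇ_; _≡ᵇ_)
open import Data.Nat.Properties using (<ᵇ⇒<; <⇒<ᵇ; ≡ᵇ⇒≡; ≮⇒≥; <-asym; ≤-<-trans)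
open import Data.Fin as Fin using (Fin; toℕ)
open import Data.Fin.Properties using (toℕ-injective)
open import Data.Bool using (Bool; true; false; not; T; if_then_else_; _≟_)
open import Data.Bool.Properties using (not-involutive; not-¬; ¬-not; T-≡)
open import Data.List using (List; []; _∷_; _++_; [_]; length; take; drop; lookup)
open import Data.List.Properties using (++-assoc; ++-identityʳ; ++-identityʳ-unique; ++-cancelˡ; ∷-injective; ∷ʳ-++)
open import Data.Maybe as Maybe using (Maybe; just; nothing)
open import Data.Maybe.Properties using (just-injective)
open import Data.Product using (∃-syntax; _×_; _,_; proj₁; proj₂; map₂)
open import Data.Product.Function.NonDependent.Propositional using (_×-⇔_)
open import Data.Sum using (_⊎_; inj₁; inj₂; [_,_]′)
open import Data.Unit using (⊤; tt)
open import Data.Empty using (⊥; ⊥-elim)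
open import Function using (_∘_; id; case_of_)
open import Function.Bundles using (_⇔_; mk⇔; Equivalence)
open import Function.Properties.Equivalence using () renaming (refl to ⇔-refl; trans to ⇔-trans)
open import Relation.Nullary using (¬_; Dec; yes; no; does)
open import Relation.Binary.PropositionalEquality using (_≡_; _≢_; refl; sym; trans; cong; subst)

open Equivalence using (to; from)

-- Outcomes of tests on a totally ordered set

not-≢ : ∀ b → not b ≢ b
not-≢ true ()
not-≢ false ()

module _ {n : ℕ} where

  Splits : Test n → Set
  Splits t = ∀ b → ∃[ q ] eval t q ≡ b

  Stops : Test n → Test n → Set
  Stops x t = ∀ b → ¬ ConsistentBoth x (t , b)

  stops : ∀ x t → ¬ ConsistentBoth x (t , true) → ¬ ConsistentBoth x (t , false) → Stops x t
  stops x t ¬cbʸ ¬cbⁿ true = ¬cbʸ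
  stops x t ¬cbʸ ¬cbⁿ false = ¬cbⁿ

  eval-eq-true : ∀ (k q : Fin n) → eval (eq k) q ≡ true → q ≡ k
  eval-eq-true k q e = toℕ-injective (≡ᵇ⇒≡ _ _ (from T-≡ e))

  eval-eq-false : ∀ (k q : Fin n) → q ≢ k → eval (eq k) q ≡ false
  eval-eq-false k q q≢k with eval (eq k) q in e
  ... | true = ⊥-elim (q≢k (eval-eq-true k q e))
  ... | false = refl

  eval-lt-true : ∀ (k q : Fin n) → eval (lt k) q ≡ true → toℕ q < toℕ k
  eval-lt-true k q e = <ᵇ⇒< _ _ (from T-≡ e)

  eval-lt-false : ∀ (k q : Fin n) → eval (lt k) q ≡ false → toℕ k ≤ toℕ q
  eval-lt-false k q e = ≮⇒≥ (λ q<k → subst T e (<⇒<ᵇ q<k))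

  consistentBoth-exclusive : ∀ (x t : Test n) → ConsistentBoth x (t , true) → ¬ ConsistentBoth x (t , false)
  consistentBoth-exclusive x (eq k) ((q , tq , xq) , (q' , tq' , xq')) _
    with eval-eq-true k q tq | eval-eq-true k q' tq'
  ... | refl | refl = case trans (sym xq) xq' of λ ()
  consistentBoth-exclusive (eq k') (lt k) ((q , tq , xq) , _) ((q' , tq' , xq') , _)
    with eval-eq-true k' q xq | eval-eq-true k' q' xq'
  ... | refl | refl = case trans (sym tq) tq' of λ ()
  consistentBoth-exclusive (lt k') (lt k) (_ , (q , tq , xq)) ((q' , tq' , xq') , _) =
    <-asym (≤-<-trans (eval-lt-false k' q xq) (eval-lt-true k q tq))
           (≤-<-trans (eval-lt-false k q' tq') (eval-lt-true k' q' xq'))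

module _ {n : ℕ} (x : Test n) where

  consistentBoth-not : ∀ t b → ConsistentBoth x (t , b) → ¬ ConsistentBoth x (t , not b)
  consistentBoth-not t true cb = consistentBoth-exclusive x t cb
  consistentBoth-not t false cb cb' = consistentBoth-exclusive x t cb' cb

  consistent-one-side : ∀ (o : Outcome n) α → ¬ ConsistentBoth x o →
                        Consistent o (x , α) → ¬ Consistent o (x , not α)
  consistent-one-side o true ¬cb co co' = ¬cb (co , co')
  consistent-one-side o false ¬cb co co' = ¬cb (co' , co)

  inconsistent-side : ∀ t b → Splits t → ¬ ConsistentBoth x (t , b) →
                      ∃[ α ] (¬ Consistent (t , b) (x , α) × Consistent (t , b) (x , not α))
  inconsistent-side t b ts ¬cb with ts b
  ... | q , tq = not (eval x q) , consistent-one-side (t , b) (eval x q) ¬cb co ,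
                 subst (λ β → Consistent (t , b) (x , β)) (sym (not-involutive _)) co
    where co = q , tq , refl

  outcome-forced : ∀ t {b α q} → ¬ Consistent (t , b) (x , α) → eval x q ≡ α → eval t q ≡ not b
  outcome-forced t {q = q} ¬co xq = ¬-not (λ tq → ¬co (q , tq , xq))

  some-outcome : ∀ t α → Splits x → ¬ Consistent (t , true) (x , α) → ¬ Consistent (t , false) (x , α) → ⊥
  some-outcome t α sx ¬coʸ ¬coⁿ with sx α
  ... | q , xq with eval t q in tq
  ...   | true = ¬coʸ (q , tq , xq)
  ...   | false = ¬coⁿ (q , tq , xq)

  stops-determined : ∀ t b α → Splits x → Stops x t →
                     Consistent (t , b) (x , α) → ¬ Consistent (t , not b) (x , α)
  stops-determined t b α sx st co co' with sx (not α)
  ... | q , xq with eval t q ≟ b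
  ... | yes tq = consistent-one-side (t , b) α (st b) co (q , tq , xq)
  ... | no tq = consistent-one-side (t , not b) α (st (not b)) co' (q , ¬-not tq , xq)

  stops-outcomes : ∀ t → Splits x → Stops x t →
                   ∃[ b ] (¬ Consistent (t , b) (x , true) × ¬ Consistent (t , not b) (x , false))
  stops-outcomes t sx st with sx true
  ... | q , xq = not (eval t q) , stops-determined t (eval t q) true sx st co ,
                 subst (λ b → ¬ Consistent (t , b) (x , false)) (sym (not-involutive _))
                       (consistent-one-side (t , eval t q) true (st _) co)
    where co = q , refl , xq

<ᵇ-irrefl : ∀ m → (m <ᵇ m) ≡ false
<ᵇ-irrefl zero = refl
<ᵇ-irrefl (suc m) = <ᵇ-irrefl m

≡ᵇ-refl : ∀ m → (m ≡ᵇ m) ≡ true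
≡ᵇ-refl zero = refl
≡ᵇ-refl (suc m) = ≡ᵇ-refl m

-- A nontrivial test t only serves to provide a second query, for x an equality test.
allowed-splits : ∀ {n c} (I : Instance n c) (x : Test n) → Allowed I x → ∀ (t : Test n) → Splits t → Splits x
allowed-splits I (lt Fin.zero) (_ , ()) _ _
allowed-splits I (lt (Fin.suc k)) _ _ _ true = Fin.zero , refl
allowed-splits I (lt (Fin.suc k)) _ _ _ false = Fin.suc k , <ᵇ-irrefl (toℕ k)
allowed-splits I (eq k) _ _ _ true = k , ≡ᵇ-refl (toℕ k)
allowed-splits I (eq k) _ t ts false with ts true | ts false
... | q₁ , e₁ | q₀ , e₀ with q₀ Fin.≟ k
...   | no q₀≢k = q₀ , eval-eq-false k q₀ q₀≢k
...   | yes refl = q₁ , eval-eq-false k q₁ λ { refl → case trans (sym e₁) e₀ of λ () }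

-- Positions and labels

map-const : ∀ {B C : Set} {v w : C} (m : Maybe B) → Maybe.map (λ _ → v) m ≡ just w → w ≡ v
map-const (just _) refl = refl
map-const nothing ()

branch-injective : ∀ (r : Pos) {b c s s'} → (r ++ [ b ]) ++ s ≡ (r ++ [ c ]) ++ s' → b ≡ c
branch-injective r {b} {c} {s} {s'} e =
  proj₁ (∷-injective (++-cancelˡ r _ _ (trans (sym (∷ʳ-++ r b s)) (trans e (∷ʳ-++ r c s')))))

branch-position : ∀ (r : Pos) {p₀ b s} → r ++ p₀ ≡ (r ++ [ b ]) ++ s → p₀ ≡ b ∷ s
branch-position r {b = b} {s} e = ++-cancelˡ r _ _ (trans e (∷ʳ-++ r b s))

root-not-in-branch : ∀ (r : Pos) {b s} → r ≢ (r ++ [ b ]) ++ s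
root-not-in-branch r {b} {s} e = case ++-identityʳ-unique r (trans e (∷ʳ-++ r b s)) of λ ()

take-lookup-drop : ∀ {A : Set} (xs : List A) (i : Fin (length xs)) →
                   xs ≡ take (toℕ i) xs ++ lookup xs i ∷ drop (suc (toℕ i)) xs
take-lookup-drop (x ∷ xs) Fin.zero = refl
take-lookup-drop (x ∷ xs) (Fin.suc i) = cong (x ∷_) (take-lookup-drop xs i)

module _ {n c : ℕ} {A : Set} where

  child : Bool → Tree n c A → Tree n c A → Tree n c A
  child true Y N = Y
  child false Y N = N

  at-child : ∀ b {a t} (Y N : Tree n c A) p → node a t Y N at (b ∷ p) ≡ child b Y N at p
  at-child true Y N p = refl
  at-child false Y N p = refl

  reaches-child : ∀ b {a t} (Y N : Tree n c A) p {q} →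
                  Reaches (node a t Y N) (b ∷ p) q → eval t q ≡ b × Reaches (child b Y N) p q
  reaches-child true Y N p r = r
  reaches-child false Y N p r = r

  leafAt-child : ∀ b {a t} (Y N : Tree n c A) z → LeafAt (node a t Y N) (b ∷ z) → LeafAt (child b Y N) z
  leafAt-child b Y N z (a' , j , e) = a' , j , trans (sym (at-child b Y N z)) e

  at-++ : ∀ (T : Tree n c A) p {S p'} → T at p ≡ just S → T at (p ++ p') ≡ S at p'
  at-++ T [] refl = refl
  at-++ (leaf _ _) (_ ∷ _) ()
  at-++ (node _ _ Y N) (true ∷ p) e = at-++ Y p e
  at-++ (node _ _ Y N) (false ∷ p) e = at-++ N p e

  reaches-++ : ∀ (T : Tree n c A) p {S p' q} → T at p ≡ just S → Reaches T (p ++ p') q → Reaches S p' q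
  reaches-++ T [] refl r = r
  reaches-++ (leaf _ _) (_ ∷ _) ()
  reaches-++ (node _ _ Y N) (true ∷ p) e (_ , r) = reaches-++ Y p e r
  reaches-++ (node _ _ Y N) (false ∷ p) e (_ , r) = reaches-++ N p e r

  testAt-node : ∀ (S : Tree n c A) p {t} → testAt S p ≡ just t → ∃[ a ] ∃[ Y ] ∃[ N ] S at p ≡ just (node a t Y N)
  testAt-node S p e with S at p
  testAt-node S p refl | just (node a t Y N) = a , Y , N , refl
  testAt-node S p ()   | just (leaf _ _)
  testAt-node S p ()   | nothing

  Reachable : Tree n c A → Set
  Reachable S = ∀ {p S'} → S at p ≡ just S' → ∃[ q ] Reaches S p q

  irreducible-reachable : ∀ (I : Instance n c) (T : Tree n c A) → Irreducible I T →
                          ∀ u {Tu} → T at u ≡ just Tu → Reachable Tu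
  irreducible-reachable I T irr u eu {p} e with proj₁ (irr (u ++ p) _ (trans (at-++ T u eu) e))
  ... | q , r = q , reaches-++ T u eu r

  reachable-child : ∀ b {a t} (Y N : Tree n c A) → Reachable (node a t Y N) → Reachable (child b Y N)
  reachable-child b Y N reach {p} e with reach (trans (at-child b Y N p) e)
  ... | q , r = q , proj₂ (reaches-child b Y N p r)

  reachable-splits : ∀ (S : Tree n c A) p {a t Y N} → Reachable S → S at p ≡ just (node a t Y N) → Splits t
  reachable-splits S p {Y = Y} {N} reach e b with reach (trans (at-++ S p e) (at-child b Y N []))
  ... | q , r = q , proj₁ (reaches-child b Y N [] (reaches-++ S p e r))

  root-splits : ∀ a t (Y N : Tree n c A) → Reachable (node a t Y N) → Splits t
  root-splits a t Y N reach = reachable-splits (node a t Y N) [] reach refl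

  data _∈ₗ_ (l : A) (D : Tree n c A) : Set where
    located : ∀ p → labelAt D p ≡ just l → l ∈ₗ D

  ∈ₗ-yes : ∀ {l a t} {Y N : Tree n c A} → l ∈ₗ Y → l ∈ₗ node a t Y N
  ∈ₗ-yes (located p e) = located (true ∷ p) e

  ∈ₗ-no : ∀ {l a t} {Y N : Tree n c A} → l ∈ₗ N → l ∈ₗ node a t Y N
  ∈ₗ-no (located p e) = located (false ∷ p) e

  ∈ₗ-node : ∀ {l a t} {Y N : Tree n c A} → l ∈ₗ node a t Y N → a ≡ l ⊎ l ∈ₗ Y ⊎ l ∈ₗ N
  ∈ₗ-node (located [] e) = inj₁ (just-injective e)
  ∈ₗ-node (located (true ∷ p) e) = inj₂ (inj₁ (located p e))
  ∈ₗ-node (located (false ∷ p) e) = inj₂ (inj₂ (located p e))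

  ∈ₗ-node-mono : ∀ {l a t} {Y N Y' N' : Tree n c A} →
                 (∀ {l} → l ∈ₗ Y → l ∈ₗ Y') → (∀ {l} → l ∈ₗ N → l ∈ₗ N') →
                 l ∈ₗ node a t Y N → l ∈ₗ node a t Y' N'
  ∈ₗ-node-mono f g (located [] e) = located [] e
  ∈ₗ-node-mono f g (located (true ∷ p) e) = ∈ₗ-yes (f (located p e))
  ∈ₗ-node-mono f g (located (false ∷ p) e) = ∈ₗ-no (g (located p e))

  data Distinct : Tree n c A → Set where
    leaf : ∀ {a j} → Distinct (leaf a j)
    node : ∀ {a t Y N} → ¬ a ∈ₗ Y → ¬ a ∈ₗ N → (∀ {l} → l ∈ₗ Y → ¬ l ∈ₗ N) →
           Distinct Y → Distinct N → Distinct (node a t Y N)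

  distinct-position : ∀ {D : Tree n c A} {l} p p' → Distinct D → labelAt D p ≡ just l → labelAt D p' ≡ just l → p ≡ p'
  distinct-position [] [] _ _ _ = refl
  distinct-position [] (true ∷ p') (node a∉Y _ _ _ _) e e' = ⊥-elim (a∉Y (located p' (trans e' (sym e))))
  distinct-position [] (false ∷ p') (node _ a∉N _ _ _) e e' = ⊥-elim (a∉N (located p' (trans e' (sym e))))
  distinct-position (true ∷ p) [] (node a∉Y _ _ _ _) e e' = ⊥-elim (a∉Y (located p (trans e (sym e'))))
  distinct-position (false ∷ p) [] (node _ a∉N _ _ _) e e' = ⊥-elim (a∉N (located p (trans e (sym e'))))
  distinct-position (true ∷ p) (true ∷ p') (node _ _ _ dY _) e e' = cong (true ∷_) (distinct-position p p' dY e e')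
  distinct-position (false ∷ p) (false ∷ p') (node _ _ _ _ dN) e e' = cong (false ∷_) (distinct-position p p' dN e e')
  distinct-position (true ∷ p) (false ∷ p') (node _ _ Y#N _ _) e e' = ⊥-elim (Y#N (located p e) (located p' e'))
  distinct-position (false ∷ p) (true ∷ p') (node _ _ Y#N _ _) e e' = ⊥-elim (Y#N (located p' e') (located p e))
  distinct-position {leaf _ _} [] (_ ∷ _) _ _ ()
  distinct-position {leaf _ _} (_ ∷ _) _ _ () _

  annot-labelAt : ∀ r (S : Tree n c A) p → labelAt (annotFrom r S) p ≡ Maybe.map (λ _ → just (r ++ p)) (S at p)
  annot-labelAt r (leaf _ _) [] = cong (just ∘ just) (sym (++-identityʳ r))
  annot-labelAt r (leaf _ _) (_ ∷ _) = refl
  annot-labelAt r (node _ _ _ _) [] = cong (just ∘ just) (sym (++-identityʳ r))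
  annot-labelAt r (node _ _ Y N) (true ∷ p) =
    trans (annot-labelAt (r ++ [ true ]) Y p) (cong (λ l → Maybe.map (λ _ → just l) (Y at p)) (∷ʳ-++ r true p))
  annot-labelAt r (node _ _ Y N) (false ∷ p) =
    trans (annot-labelAt (r ++ [ false ]) N p) (cong (λ l → Maybe.map (λ _ → just l) (N at p)) (∷ʳ-++ r false p))

  annot-labelAt⁺ : ∀ r (S : Tree n c A) p {S'} → S at p ≡ just S' → labelAt (annotFrom r S) p ≡ just (just (r ++ p))
  annot-labelAt⁺ r S p e = trans (annot-labelAt r S p) (cong (Maybe.map (λ _ → just (r ++ p))) e)

  annot-labelAt⁻ : ∀ r (S : Tree n c A) p {l} → labelAt (annotFrom r S) p ≡ just l → l ≡ just (r ++ p)
  annot-labelAt⁻ r S p e = map-const (S at p) (trans (sym (annot-labelAt r S p)) e)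

  annot-reaches : ∀ r (S : Tree n c A) p {q} → Reaches (annotFrom r S) p q ⇔ Reaches S p q
  annot-reaches r S [] = ⇔-refl
  annot-reaches r (leaf _ _) (_ ∷ _) = ⇔-refl
  annot-reaches r (node _ _ Y N) (true ∷ p) =
    mk⇔ (map₂ (to (annot-reaches (r ++ [ true ]) Y p))) (map₂ (from (annot-reaches (r ++ [ true ]) Y p)))
  annot-reaches r (node _ _ Y N) (false ∷ p) =
    mk⇔ (map₂ (to (annot-reaches (r ++ [ false ]) N p))) (map₂ (from (annot-reaches (r ++ [ false ]) N p)))

module _ {n c : ℕ} where

  InBranch : Pos → Bool → Tree n c (Maybe Pos) → Set
  InBranch r b D = ∀ {l} → l ∈ₗ D → ∃[ s ] l ≡ just ((r ++ [ b ]) ++ s)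

  annot-inBranch : ∀ {A : Set} r b (S : Tree n c A) → InBranch r b (annotFrom (r ++ [ b ]) S)
  annot-inBranch r b S (located p e) = p , annot-labelAt⁻ (r ++ [ b ]) S p e

  inBranch-∌-root : ∀ {r b} {D : Tree n c (Maybe Pos)} → InBranch r b D → ¬ just r ∈ₗ D
  inBranch-∌-root {r} br m with br m
  ... | s , e = root-not-in-branch r (just-injective e)

  inBranch-∌ : ∀ {r b d s l} {D : Tree n c (Maybe Pos)} → InBranch r b D → b ≢ d →
               l ≡ (r ++ [ d ]) ++ s → ¬ just l ∈ₗ D
  inBranch-∌ {r} br b≢d refl m with br m
  ... | s , e = b≢d (sym (branch-injective r (just-injective e)))

  inBranch-position : ∀ {r b p₀} (D : Tree n c (Maybe Pos)) p → InBranch r b D → labelAt D p ≡ just (just (r ++ p₀)) →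
                      ∃[ s ] (p₀ ≡ b ∷ s × labelAt D p ≡ just (just ((r ++ [ b ]) ++ s)))
  inBranch-position {r} {b} D p br e with br (located p e)
  ... | s , e' = s , branch-position r (just-injective e') , trans e (cong just e')

  annot-position : ∀ {A : Set} r b (S : Tree n c A) p {p₀} →
                   labelAt (annotFrom (r ++ [ b ]) S) p ≡ just (just (r ++ p₀)) → p₀ ≡ b ∷ p
  annot-position r b S p e = branch-position r (just-injective (annot-labelAt⁻ (r ++ [ b ]) S p e))

  hasCopy⇔∈ₗ : ∀ {D : Tree n c (Maybe Pos)} {z} → HasCopy D z ⇔ just z ∈ₗ D
  hasCopy⇔∈ₗ = mk⇔ (λ (p , e) → located p e) (λ { (located p e) → p , e })

  annot-distinct : ∀ {A : Set} r (S : Tree n c A) → Distinct (annotFrom r S)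
  annot-distinct r (leaf _ _) = leaf
  annot-distinct r (node _ _ Y N) =
    node (inBranch-∌-root (annot-inBranch r true Y)) (inBranch-∌-root (annot-inBranch r false N))
         disjoint (annot-distinct (r ++ [ true ]) Y) (annot-distinct (r ++ [ false ]) N)
    where
    disjoint : ∀ {l} → l ∈ₗ annotFrom (r ++ [ true ]) Y → ¬ l ∈ₗ annotFrom (r ++ [ false ]) N
    disjoint m m' with annot-inBranch r true Y m | annot-inBranch r false N m'
    ... | s , refl | s' , e = case branch-injective r (just-injective e) of λ ()

-- Splitting around x

module _ {n c : ℕ} {A : Set} (x : Test n) where

  data SplitStep (α : Bool) (a : A) (t : Test n) (Y N : Tree n c A) : Tree n c A → Set where
    keepʸ : ConsistentBoth x (t , true) → Consistent (t , false) (x , α) → SplitStep α a t Y N (node a t (splitSide x α Y) N)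
    dropʸ : ConsistentBoth x (t , true) → ¬ Consistent (t , false) (x , α) → SplitStep α a t Y N (splitSide x α Y)
    keepⁿ : ConsistentBoth x (t , false) → Consistent (t , true) (x , α) → SplitStep α a t Y N (node a t Y (splitSide x α N))
    dropⁿ : ConsistentBoth x (t , false) → ¬ Consistent (t , true) (x , α) → SplitStep α a t Y N (splitSide x α N)
    stopʸ : Stops x t → Consistent (t , true) (x , α) → SplitStep α a t Y N Y
    stopⁿ : Stops x t → ¬ Consistent (t , true) (x , α) → SplitStep α a t Y N N

  splitStep : ∀ α a t (Y N : Tree n c A) → SplitStep α a t Y N (splitSide x α (node a t Y N))
  splitStep α a t Y N =
    view (consistentBoth? x (t , true)) (consistent? (t , false) (x , α))
         (consistentBoth? x (t , false)) (consistent? (t , true) (x , α))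
    where
    view : (cbʸ : Dec (ConsistentBoth x (t , true))) (coⁿ : Dec (Consistent (t , false) (x , α)))
           (cbⁿ : Dec (ConsistentBoth x (t , false))) (coʸ : Dec (Consistent (t , true) (x , α))) → SplitStep α a t Y N
      (if does cbʸ then (if does coⁿ then node a t (splitSide x α Y) N else splitSide x α Y)
       else if does cbⁿ then (if does coʸ then node a t Y (splitSide x α N) else splitSide x α N)
       else (if does coʸ then Y else N))
    view (yes cb) (yes co) _ _ = keepʸ cb co
    view (yes cb) (no ¬co) _ _ = dropʸ cb ¬co
    view (no _) _ (yes cb) (yes co) = keepⁿ cb co
    view (no _) _ (yes cb) (no ¬co) = dropⁿ cb ¬co
    view (no ¬cbʸ) _ (no ¬cbⁿ) (yes co) = stopʸ (stops x t ¬cbʸ ¬cbⁿ) co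
    view (no ¬cbʸ) _ (no ¬cbⁿ) (no ¬co) = stopⁿ (stops x t ¬cbʸ ¬cbⁿ) ¬co

  split-⊆ : ∀ α (D : Tree n c A) {l} → l ∈ₗ splitSide x α D → l ∈ₗ D
  split-⊆ α (leaf a j) m = m
  split-⊆ α (node a t Y N) = go (splitStep α a t Y N)
    where
    go : ∀ {D l} → SplitStep α a t Y N D → l ∈ₗ D → l ∈ₗ node a t Y N
    go (keepʸ _ _) = ∈ₗ-node-mono (split-⊆ α Y) id
    go (dropʸ _ _) = ∈ₗ-yes ∘ split-⊆ α Y
    go (keepⁿ _ _) = ∈ₗ-node-mono id (split-⊆ α N)
    go (dropⁿ _ _) = ∈ₗ-no ∘ split-⊆ α N
    go (stopʸ _ _) = ∈ₗ-yes
    go (stopⁿ _ _) = ∈ₗ-no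

  split-distinct : ∀ α (D : Tree n c A) → Distinct D → Distinct (splitSide x α D)
  split-distinct α (leaf a j) d = d
  split-distinct α (node a t Y N) (node a∉Y a∉N Y#N dY dN) = go (splitStep α a t Y N)
    where
    go : ∀ {D} → SplitStep α a t Y N D → Distinct D
    go (keepʸ _ _) = node (a∉Y ∘ split-⊆ α Y) a∉N (Y#N ∘ split-⊆ α Y) (split-distinct α Y dY) dN
    go (dropʸ _ _) = split-distinct α Y dY
    go (keepⁿ _ _) = node a∉Y (a∉N ∘ split-⊆ α N) (λ m m' → Y#N m (split-⊆ α N m')) dY (split-distinct α N dN)
    go (dropⁿ _ _) = split-distinct α N dN
    go (stopʸ _ _) = dY
    go (stopⁿ _ _) = dN

  data PathStep (t : Test n) (Y N : Tree n c A) : Pos → Set where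
    continues : ∀ b → ConsistentBoth x (t , b) → PathStep t Y N (b ∷ xPath x (child b Y N))
    ends : Stops x t → PathStep t Y N []

  pathStep : ∀ a t (Y N : Tree n c A) → PathStep t Y N (xPath x (node a t Y N))
  pathStep a t Y N = view (consistentBoth? x (t , true)) (consistentBoth? x (t , false))
    where
    view : (cbʸ : Dec (ConsistentBoth x (t , true))) (cbⁿ : Dec (ConsistentBoth x (t , false))) →
           PathStep t Y N (if does cbʸ then true ∷ xPath x Y else if does cbⁿ then false ∷ xPath x N else [])
    view (yes cb) _ = continues true cb
    view (no _) (yes cb) = continues false cb
    view (no ¬cbʸ) (no ¬cbⁿ) = ends (stops x t ¬cbʸ ¬cbⁿ)

  xPath-∷ : ∀ a t (Y N : Tree n c A) {b ps} → xPath x (node a t Y N) ≡ b ∷ ps →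
            ConsistentBoth x (t , b) × xPath x (child b Y N) ≡ ps
  xPath-∷ a t Y N = go (pathStep a t Y N)
    where
    go : ∀ {ps₀ b ps} → PathStep t Y N ps₀ → ps₀ ≡ b ∷ ps → ConsistentBoth x (t , b) × xPath x (child b Y N) ≡ ps
    go (continues b cb) refl = cb , refl
    go (ends _) ()

  xPath-[] : ∀ a t (Y N : Tree n c A) → xPath x (node a t Y N) ≡ [] → Stops x t
  xPath-[] a t Y N = go (pathStep a t Y N)
    where
    go : ∀ {ps₀} → PathStep t Y N ps₀ → ps₀ ≡ [] → Stops x t
    go (continues _ _) ()
    go (ends st) _ = st

  xPath-at : ∀ (S : Tree n c A) P {ps S'} → xPath x S ≡ P ++ ps → S at P ≡ just S' → xPath x S' ≡ ps
  xPath-at S [] e refl = e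
  xPath-at (leaf _ _) (_ ∷ _) _ ()
  xPath-at (node a t Y N) (b ∷ P) e atP with xPath-∷ a t Y N e
  ... | _ , e' = xPath-at (child b Y N) P e' (trans (sym (at-child b Y N P)) atP)

sideFrom : ∀ {n c} {A : Set} → Test n → Bool → Pos → Tree n c A → Tree n c (Maybe Pos)
sideFrom x α r S = splitSide x α (annotFrom r S)

annotSplitStep : ∀ {n c} {A : Set} (x : Test n) α r a t (Y N : Tree n c A) →
                 SplitStep x α (just r) t (annotFrom (r ++ [ true ]) Y) (annotFrom (r ++ [ false ]) N) (sideFrom x α r (node a t Y N))
annotSplitStep x α r a t Y N = splitStep x α (just r) t (annotFrom (r ++ [ true ]) Y) (annotFrom (r ++ [ false ]) N)

module _ {n c : ℕ} {A : Set} (x : Test n) (α : Bool) (r : Pos) (a : A) (t : Test n) (Y N : Tree n c A) where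

  continuing-∈ₗ : ∀ b → ConsistentBoth x (t , b) → ∀ {l} →
    l ∈ₗ sideFrom x α r (node a t Y N) ⇔
      ((Consistent (t , not b) (x , α) × (l ≡ just r ⊎ l ∈ₗ annotFrom (r ++ [ not b ]) (child (not b) Y N)))
       ⊎ l ∈ₗ sideFrom x α (r ++ [ b ]) (child b Y N))
  continuing-∈ₗ b cb = go b cb (annotSplitStep x α r a t Y N)
    where
    go : ∀ b → ConsistentBoth x (t , b) →
         ∀ {D} → SplitStep x α (just r) t (annotFrom (r ++ [ true ]) Y) (annotFrom (r ++ [ false ]) N) D →
         ∀ {l} → l ∈ₗ D ⇔
           ((Consistent (t , not b) (x , α) × (l ≡ just r ⊎ l ∈ₗ annotFrom (r ++ [ not b ]) (child (not b) Y N)))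
            ⊎ l ∈ₗ sideFrom x α (r ++ [ b ]) (child b Y N))
    go true _ (keepʸ _ co) = mk⇔
      ([ (λ { refl → inj₁ (co , inj₁ refl) }) , [ inj₂ , (λ m → inj₁ (co , inj₂ m)) ]′ ]′ ∘ ∈ₗ-node)
      λ where
        (inj₁ (_ , inj₁ refl)) → located [] refl
        (inj₁ (_ , inj₂ m)) → ∈ₗ-no m
        (inj₂ m) → ∈ₗ-yes m
    go false _ (keepⁿ _ co) = mk⇔
      ([ (λ { refl → inj₁ (co , inj₁ refl) }) , [ (λ m → inj₁ (co , inj₂ m)) , inj₂ ]′ ]′ ∘ ∈ₗ-node)
      λ where
        (inj₁ (_ , inj₁ refl)) → located [] refl
        (inj₁ (_ , inj₂ m)) → ∈ₗ-yes m
        (inj₂ m) → ∈ₗ-no m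
    go true _ (dropʸ _ ¬co) = mk⇔ inj₂ λ where
      (inj₁ (co , _)) → ⊥-elim (¬co co)
      (inj₂ m) → m
    go false _ (dropⁿ _ ¬co) = mk⇔ inj₂ λ where
      (inj₁ (co , _)) → ⊥-elim (¬co co)
      (inj₂ m) → m
    go true cb (keepⁿ cb' _) = ⊥-elim (consistentBoth-exclusive x t cb cb')
    go true cb (dropⁿ cb' _) = ⊥-elim (consistentBoth-exclusive x t cb cb')
    go false cb (keepʸ cb' _) = ⊥-elim (consistentBoth-exclusive x t cb' cb)
    go false cb (dropʸ cb' _) = ⊥-elim (consistentBoth-exclusive x t cb' cb)
    go b cb (stopʸ st _) = ⊥-elim (st b cb)
    go b cb (stopⁿ st _) = ⊥-elim (st b cb)

  ∈ₗ-step : ∀ b → ConsistentBoth x (t , b) → ∀ {l w} → l ≡ (r ++ [ b ]) ++ w →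
           just l ∈ₗ sideFrom x α r (node a t Y N) ⇔ just l ∈ₗ sideFrom x α (r ++ [ b ]) (child b Y N)
  ∈ₗ-step b cb {w = w} refl =
    mk⇔ ([ (λ (_ , m) → ⊥-elim (not-sibling m)) , id ]′ ∘ to (continuing-∈ₗ b cb)) (from (continuing-∈ₗ b cb) ∘ inj₂)
    where
    not-sibling : ¬ (just ((r ++ [ b ]) ++ w) ≡ just r ⊎ just ((r ++ [ b ]) ++ w) ∈ₗ annotFrom (r ++ [ not b ]) (child (not b) Y N))
    not-sibling (inj₁ e) = root-not-in-branch r (sym (just-injective e))
    not-sibling (inj₂ m) = inBranch-∌ (annot-inBranch r (not b) _) (not-≢ b) refl m

  dropped-inBranch : ∀ b → ConsistentBoth x (t , b) → ¬ Consistent (t , not b) (x , α) →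
                     InBranch r b (sideFrom x α r (node a t Y N))
  dropped-inBranch b cb ¬co =
    [ (λ (co , _) → ⊥-elim (¬co co)) , annot-inBranch r b (child b Y N) ∘ split-⊆ x α _ ]′ ∘ to (continuing-∈ₗ b cb)

  kept-root : ∀ b → ConsistentBoth x (t , b) → Consistent (t , not b) (x , α) → just r ∈ₗ sideFrom x α r (node a t Y N)
  kept-root b cb co = from (continuing-∈ₗ b cb) (inj₁ (co , inj₁ refl))

  kept-sibling : ∀ b → ConsistentBoth x (t , b) → Consistent (t , not b) (x , α) → ∀ s → IsNode (child (not b) Y N) s →
                 just ((r ++ [ not b ]) ++ s) ∈ₗ sideFrom x α r (node a t Y N)
  kept-sibling b cb co s (_ , e) =
    from (continuing-∈ₗ b cb) (inj₁ (co , inj₂ (located s (annot-labelAt⁺ (r ++ [ not b ]) (child (not b) Y N) s e))))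

  stopping-inBranch : ∀ b → Splits x → Stops x t → ¬ Consistent (t , b) (x , α) →
                      InBranch r (not b) (sideFrom x α r (node a t Y N))
  stopping-inBranch b sx st = go b (annotSplitStep x α r a t Y N)
    where
    go : ∀ b {D} → SplitStep x α (just r) t (annotFrom (r ++ [ true ]) Y) (annotFrom (r ++ [ false ]) N) D →
         ¬ Consistent (t , b) (x , α) → InBranch r (not b) D
    go true (stopʸ _ coʸ) ¬co = ⊥-elim (¬co coʸ)
    go true (stopⁿ _ _) _ = annot-inBranch r false N
    go false (stopʸ _ _) _ = annot-inBranch r true Y
    go false (stopⁿ _ ¬coʸ) ¬coⁿ = ⊥-elim (some-outcome x t α sx ¬coʸ ¬coⁿ)
    go _ (keepʸ cb _) _ = ⊥-elim (st true cb)
    go _ (dropʸ cb _) _ = ⊥-elim (st true cb)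
    go _ (keepⁿ cb _) _ = ⊥-elim (st false cb)
    go _ (dropⁿ cb _) _ = ⊥-elim (st false cb)

module _ {n c : ℕ} {A : Set} (x : Test n) (α : Bool) where

  ∈ₗ-along : ∀ (S : Tree n c A) P {ps S' r r' l w} → xPath x S ≡ P ++ ps → S at P ≡ just S' →
            r' ≡ r ++ P → l ≡ r' ++ w → just l ∈ₗ sideFrom x α r S ⇔ just l ∈ₗ sideFrom x α r' S'
  ∈ₗ-along S [] {r = r} _ refl refl _ rewrite ++-identityʳ r = ⇔-refl
  ∈ₗ-along (leaf _ _) (_ ∷ _) _ ()
  ∈ₗ-along (node a t Y N) (b ∷ P) {r = r} {w = w} e atP refl refl with xPath-∷ x a t Y N e
  ... | cb , e' = ⇔-trans (∈ₗ-step x α r a t Y N b cb (trans (cong (_++ w) below) (++-assoc (r ++ [ b ]) P w)))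
                          (∈ₗ-along (child b Y N) P e' (trans (sym (at-child b Y N P)) atP) below refl)
    where below = sym (∷ʳ-++ r b P)

module _ {n c : ℕ} {A : Set} (x : Test n) (sx : Splits x) where

  -- Every node deleted from the α side has lost a branch that queries on the α side never take.
  reaches-copy→reaches : ∀ α r (S : Tree n c A) p {p₀ q} → labelAt (sideFrom x α r S) p ≡ just (just (r ++ p₀)) →
                         eval x q ≡ α → Reaches (sideFrom x α r S) p q → Reaches S p₀ q
  reaches-copy→reaches α r (leaf _ _) [] e _ _ with ++-identityʳ-unique r (just-injective (just-injective e))
  ... | refl = tt
  reaches-copy→reaches α r (node a t Y N) p {q = q} e xq =
    go (annotSplitStep x α r a t Y N) p e
    where
    Yₐ = annotFrom (r ++ [ true ]) Y
    Nₐ = annotFrom (r ++ [ false ]) N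
    Yₛ = splitSide x α Yₐ
    Nₛ = splitSide x α Nₐ
    go : ∀ {D p₀} → SplitStep x α (just r) t Yₐ Nₐ D → ∀ p → labelAt D p ≡ just (just (r ++ p₀)) →
         Reaches D p q → Reaches (node a t Y N) p₀ q
    go (keepʸ _ _) [] e _ with ++-identityʳ-unique r (just-injective (just-injective e))
    ... | refl = tt
    go (keepⁿ _ _) [] e _ with ++-identityʳ-unique r (just-injective (just-injective e))
    ... | refl = tt
    go (keepʸ _ _) (true ∷ p) e (tq , rq) with inBranch-position Yₛ p (annot-inBranch r true Y ∘ split-⊆ x α Yₐ) e
    ... | s , refl , e' = tq , reaches-copy→reaches α (r ++ [ true ]) Y p e' xq rq
    go (keepʸ _ _) (false ∷ p) e (tq , rq) with annot-position r false N p e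
    ... | refl = tq , to (annot-reaches (r ++ [ false ]) N p) rq
    go (keepⁿ _ _) (true ∷ p) e (tq , rq) with annot-position r true Y p e
    ... | refl = tq , to (annot-reaches (r ++ [ true ]) Y p) rq
    go (keepⁿ _ _) (false ∷ p) e (tq , rq) with inBranch-position Nₛ p (annot-inBranch r false N ∘ split-⊆ x α Nₐ) e
    ... | s , refl , e' = tq , reaches-copy→reaches α (r ++ [ false ]) N p e' xq rq
    go (dropʸ _ ¬co) p e rq with inBranch-position Yₛ p (annot-inBranch r true Y ∘ split-⊆ x α Yₐ) e
    ... | s , refl , e' = outcome-forced x t ¬co xq , reaches-copy→reaches α (r ++ [ true ]) Y p e' xq rq
    go (dropⁿ _ ¬co) p e rq with inBranch-position Nₛ p (annot-inBranch r false N ∘ split-⊆ x α Nₐ) e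
    ... | s , refl , e' = outcome-forced x t ¬co xq , reaches-copy→reaches α (r ++ [ false ]) N p e' xq rq
    go (stopʸ st co) p e rq with annot-position r true Y p e
    ... | refl = outcome-forced x t (stops-determined x t true α sx st co) xq , to (annot-reaches (r ++ [ true ]) Y p) rq
    go (stopⁿ _ ¬co) p e rq with annot-position r false N p e
    ... | refl = outcome-forced x t ¬co xq , to (annot-reaches (r ++ [ false ]) N p) rq

  reaches-leaf→reaches-copy : ∀ α r (S : Tree n c A) z {q} → LeafAt S z → Reaches S z q → eval x q ≡ α →
    ∃[ p ] (labelAt (sideFrom x α r S) p ≡ just (just (r ++ z)) × Reaches (sideFrom x α r S) p q)
  reaches-leaf→reaches-copy α r (leaf _ _) [] _ _ _ = [] , cong (just ∘ just) (sym (++-identityʳ r)) , tt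
  reaches-leaf→reaches-copy α r (leaf _ _) (_ ∷ _) (_ , _ , ()) _ _
  reaches-leaf→reaches-copy α r (node _ _ _ _) [] (_ , _ , ()) _ _
  reaches-leaf→reaches-copy α r (node a t Y N) (b ∷ z) {q} lf rz xq =
    go (annotSplitStep x α r a t Y N) b
       (leafAt-child b Y N z lf) (proj₁ (reaches-child b Y N z rz)) (proj₂ (reaches-child b Y N z rz))
    where
    Yₐ = annotFrom (r ++ [ true ]) Y
    Nₐ = annotFrom (r ++ [ false ]) N
    relabel : ∀ b → just (just ((r ++ [ b ]) ++ z)) ≡ just (just (r ++ b ∷ z))
    relabel b = cong (just ∘ just) (∷ʳ-++ r b z)
    annot-copy : ∀ b (C : Tree n c A) → LeafAt C z → Reaches C z q →
                 ∃[ p ] (labelAt (annotFrom (r ++ [ b ]) C) p ≡ just (just (r ++ b ∷ z)) × Reaches (annotFrom (r ++ [ b ]) C) p q)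
    annot-copy b C (_ , _ , e) rz = z , trans (annot-labelAt⁺ (r ++ [ b ]) C z e) (relabel b) , from (annot-reaches (r ++ [ b ]) C z) rz
    go : ∀ {D} → SplitStep x α (just r) t Yₐ Nₐ D →
         ∀ b → LeafAt (child b Y N) z → eval t q ≡ b → Reaches (child b Y N) z q →
         ∃[ p ] (labelAt D p ≡ just (just (r ++ b ∷ z)) × Reaches D p q)
    go (keepʸ _ _) true lf tq rz with reaches-leaf→reaches-copy α (r ++ [ true ]) Y z lf rz xq
    ... | p , e , rp = true ∷ p , trans e (relabel true) , tq , rp
    go (keepʸ _ _) false lf tq rz with annot-copy false N lf rz
    ... | p , e , rp = false ∷ p , e , tq , rp
    go (keepⁿ _ _) true lf tq rz with annot-copy true Y lf rz
    ... | p , e , rp = true ∷ p , e , tq , rp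
    go (keepⁿ _ _) false lf tq rz with reaches-leaf→reaches-copy α (r ++ [ false ]) N z lf rz xq
    ... | p , e , rp = false ∷ p , trans e (relabel false) , tq , rp
    go (dropʸ _ _) true lf tq rz with reaches-leaf→reaches-copy α (r ++ [ true ]) Y z lf rz xq
    ... | p , e , rp = p , trans e (relabel true) , rp
    go (dropⁿ _ _) false lf tq rz with reaches-leaf→reaches-copy α (r ++ [ false ]) N z lf rz xq
    ... | p , e , rp = p , trans e (relabel false) , rp
    go (stopʸ _ _) true lf tq rz = annot-copy true Y lf rz
    go (stopⁿ _ _) false lf tq rz = annot-copy false N lf rz
    go (dropʸ _ ¬co) false lf tq rz = ⊥-elim (¬co (q , tq , xq))
    go (dropⁿ _ ¬co) true lf tq rz = ⊥-elim (¬co (q , tq , xq))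
    go (stopʸ st co) false lf tq rz = ⊥-elim (stops-determined x t true α sx st co (q , tq , xq))
    go (stopⁿ _ ¬co) true lf tq rz = ⊥-elim (¬co (q , tq , xq))

  off-path-deleted : ∀ r (S : Tree n c A) z → Reachable S → LeafAt S z → z ≢ xPath x S →
                     ∃[ δ ] ¬ just (r ++ z) ∈ₗ sideFrom x δ r S
  off-path-deleted r (leaf _ _) [] _ _ z≢ = ⊥-elim (z≢ refl)
  off-path-deleted r (leaf _ _) (_ ∷ _) _ (_ , _ , ()) _
  off-path-deleted r (node _ _ _ _) [] _ (_ , _ , ()) _
  off-path-deleted r (node a t Y N) (d ∷ z) reach lf = go d (pathStep x a t Y N) (leafAt-child d Y N z lf)
    where
    go : ∀ d {ps} → PathStep x t Y N ps → LeafAt (child d Y N) z → d ∷ z ≢ ps →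
         ∃[ δ ] ¬ just (r ++ d ∷ z) ∈ₗ sideFrom x δ r (node a t Y N)
    go d (continues b cb) lf z≢ with d ≟ b
    ... | yes refl =
      let δ , ∉ = off-path-deleted (r ++ [ d ]) (child d Y N) z (reachable-child d Y N reach) lf (z≢ ∘ cong (d ∷_))
      in δ , subst (λ l → ¬ just l ∈ₗ sideFrom x δ (r ++ [ d ]) (child d Y N)) (∷ʳ-++ r d z) ∉
             ∘ to (∈ₗ-step x δ r a t Y N d cb (sym (∷ʳ-++ r d z)))
    ... | no d≢b with ¬-not d≢b
    ...   | refl =
      let δ , ¬co , _ = inconsistent-side x t (not b) (root-splits a t Y N reach) (consistentBoth-not x t b cb)
      in δ , inBranch-∌ (dropped-inBranch x δ r a t Y N b cb ¬co) (not-¬ refl) (sym (∷ʳ-++ r (not b) z))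
    go d (ends st) _ _ =
      let δ , ¬co , _ = inconsistent-side x t d (root-splits a t Y N reach) (st d)
      in δ , inBranch-∌ (stopping-inBranch x δ r a t Y N d sx st ¬co) (not-≢ d) (sym (∷ʳ-++ r d z))

module _ {n c : ℕ} {A : Set} (x : Test n) (S : Tree n c A) (reach : Reachable S) where

  sibling-deleted : ∀ {P b ps t} → xPath x S ≡ P ++ b ∷ ps → testAt S P ≡ just t →
    ∃[ α ] (¬ Consistent (t , not b) (x , α) × Consistent (t , not b) (x , not α)
      × ¬ HasCopy (sideTree x α S) P
      × (∀ s → ¬ HasCopy (sideTree x α S) ((P ++ [ not b ]) ++ s))
      × HasCopy (sideTree x (not α) S) P
      × (∀ s → IsNode S ((P ++ [ not b ]) ++ s) → HasCopy (sideTree x (not α) S) ((P ++ [ not b ]) ++ s)))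
  sibling-deleted {P} {b} {t = t} e et with testAt-node S P et
  ... | a , Y , N , atP with xPath-∷ x a t Y N (xPath-at x S P e atP)
  ... | cb , _ with inconsistent-side x t (not b) (reachable-splits S P reach atP) (consistentBoth-not x t b cb)
  ... | α , ¬co , co =
      α , ¬co , co
    , inBranch-∌-root deleted ∘ to (along α (sym (++-identityʳ P))) ∘ to hasCopy⇔∈ₗ
    , (λ s → inBranch-∌ deleted (not-¬ refl) refl ∘ to (along α (++-assoc P [ not b ] s)) ∘ to hasCopy⇔∈ₗ)
    , from hasCopy⇔∈ₗ (from (along (not α) (sym (++-identityʳ P))) (kept-root x (not α) P a t Y N b cb co))
    , λ s (S' , e') → from hasCopy⇔∈ₗ (from (along (not α) (++-assoc P [ not b ] s))
        (kept-sibling x (not α) P a t Y N b cb co s (S' , trans (sym (at-++ S (P ++ [ not b ]) sibling-at)) e')))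
    where
    deleted = dropped-inBranch x α P a t Y N b cb ¬co
    along : ∀ β {l w} → l ≡ P ++ w → just l ∈ₗ sideTree x β S ⇔ just l ∈ₗ sideFrom x β P (node a t Y N)
    along β = ∈ₗ-along x β S P e atP refl
    sibling-at : S at (P ++ [ not b ]) ≡ just (child (not b) Y N)
    sibling-at = trans (at-++ S P atP) (at-child (not b) Y N [])

  end-deleted : (∀ (t : Test n) → Splits t → Splits x) → ∀ {t} → testAt S (xPath x S) ≡ just t →
    ∃[ b ] (¬ Consistent (t , b) (x , true) × ¬ Consistent (t , not b) (x , false)
      × ¬ HasCopy (sideTree x true S) (xPath x S)
      × (∀ s → ¬ HasCopy (sideTree x true S) ((xPath x S ++ [ b ]) ++ s))
      × ¬ HasCopy (sideTree x false S) (xPath x S)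
      × (∀ s → ¬ HasCopy (sideTree x false S) ((xPath x S ++ [ not b ]) ++ s)))
  end-deleted x-splits {t} et with testAt-node S (xPath x S) et
  ... | a , Y , N , atP with xPath-[] x a t Y N (xPath-at x S (xPath x S) (sym (++-identityʳ _)) atP)
  ... | st with x-splits t (reachable-splits S (xPath x S) reach atP)
  ... | sx with stops-outcomes x t sx st
  ... | b , ¬coʸ , ¬coⁿ =
      b , ¬coʸ , ¬coⁿ
    , inBranch-∌-root (stopped true b ¬coʸ) ∘ to (along true (sym (++-identityʳ P))) ∘ to hasCopy⇔∈ₗ
    , (λ s → inBranch-∌ (stopped true b ¬coʸ) (not-≢ b) refl ∘ to (along true (++-assoc P [ b ] s)) ∘ to hasCopy⇔∈ₗ)
    , inBranch-∌-root (stopped false (not b) ¬coⁿ) ∘ to (along false (sym (++-identityʳ P))) ∘ to hasCopy⇔∈ₗ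
    , (λ s → inBranch-∌ (stopped false (not b) ¬coⁿ) (not-≢ (not b)) refl
             ∘ to (along false (++-assoc P [ not b ] s)) ∘ to hasCopy⇔∈ₗ)
    where
    P = xPath x S
    stopped : ∀ α d → ¬ Consistent (t , d) (x , α) → InBranch P (not d) (sideFrom x α P (node a t Y N))
    stopped α d = stopping-inBranch x α P a t Y N d sx st
    along : ∀ β {l w} → l ≡ P ++ w → just l ∈ₗ sideTree x β S ⇔ just l ∈ₗ sideFrom x β P (node a t Y N)
    along β = ∈ₗ-along x β S P (sym (++-identityʳ P)) atP refl

module _ {n c : ℕ} {A : Set} (x : Test n) where

  splitAround-labelAt : ∀ (S : Tree n c A) γ p → labelAt (splitAround x S) (γ ∷ p) ≡ labelAt (sideTree x γ S) p
  splitAround-labelAt S true p = refl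
  splitAround-labelAt S false p = refl

  reaches-splitAround : ∀ (S : Tree n c A) γ p {q} →
                        Reaches (splitAround x S) (γ ∷ p) q ⇔ (eval x q ≡ γ × Reaches (sideTree x γ S) p q)
  reaches-splitAround S true p = ⇔-refl
  reaches-splitAround S false p = ⇔-refl

  off-path-leaf : ∀ (S : Tree n c A) → (∀ (t : Test n) → Splits t → Splits x) → Reachable S →
                  ∀ z → LeafAt S z → z ≢ xPath x S →
    ∃[ p ] (labelAt (splitAround x S) p ≡ just (just z)
      × (∀ p' → labelAt (splitAround x S) p' ≡ just (just z) → p' ≡ p)
      × (∀ q → Reaches (splitAround x S) p q ⇔ Reaches S z q))
  off-path-leaf (leaf _ _) _ _ [] _ z≢ = ⊥-elim (z≢ refl)
  off-path-leaf (leaf _ _) _ _ (_ ∷ _) (_ , _ , ()) _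
  off-path-leaf S@(node a t Y N) x-splits reach z lf z≢
    with x-splits t (root-splits a t Y N reach)
  ... | sx with reach {z} (proj₂ (proj₂ lf)) | off-path-deleted x sx [] S z reach lf z≢
  ... | q₀ , r₀ | δ , ∉δ with reaches-leaf→reaches-copy x sx (eval x q₀) [] S z lf r₀ refl
  ... | p , lp , _ = β ∷ p , trans (splitAround-labelAt S β p) lp , unique , reaches
    where
    β = eval x q₀
    side-of : ∀ {γ} → just z ∈ₗ sideTree x γ S → γ ≡ not δ
    side-of m = ¬-not λ { refl → ∉δ m }
    copy-unique : ∀ γ p' → labelAt (sideTree x γ S) p' ≡ just (just z) → γ ≡ β × p' ≡ p
    copy-unique γ p' e with trans (side-of (located p' e)) (sym (side-of (located p lp)))
    ... | refl = refl , distinct-position p' p (split-distinct x β (annotFrom [] S) (annot-distinct [] S)) e lp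
    unique : ∀ p' → labelAt (splitAround x S) p' ≡ just (just z) → p' ≡ β ∷ p
    unique [] ()
    unique (γ ∷ p') e with copy-unique γ p' (trans (sym (splitAround-labelAt S γ p')) e)
    ... | refl , refl = refl
    reached : ∀ {q} γ p' → labelAt (sideTree x γ S) p' ≡ just (just z) → eval x q ≡ γ →
              Reaches (sideTree x γ S) p' q → Reaches (splitAround x S) (β ∷ p) q
    reached γ p' e xq rq with copy-unique γ p' e
    ... | refl , refl = from (reaches-splitAround S β p) (xq , rq)
    reaches : ∀ q → Reaches (splitAround x S) (β ∷ p) q ⇔ Reaches S z q
    reaches q = mk⇔
      (λ rq → let xq , rs = to (reaches-splitAround S β p) rq in reaches-copy→reaches x sx β [] S p lp xq rs)
      (λ rz → let p₁ , lp₁ , rp₁ = reaches-leaf→reaches-copy x sx (eval x q) [] S z lf rz refl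
              in reached (eval x q) p₁ lp₁ refl rp₁)

lemma2 : ∀ {n c} (I : Instance n c) (T : Tree n c ⊤) →
    IsDecisionTree I T → Irreducible I T →
    (u : Pos) (Tu : Tree n c ⊤) → T at u ≡ just Tu →
    (x : Test n) → Allowed I x →
    -- (i)
    (∀ (i : Fin (length (xPath x Tu))) (t : Test n) →
        testAt Tu (take (toℕ i) (xPath x Tu)) ≡ just t →
        ∃[ α ] (¬ Consistent (t , not (lookup (xPath x Tu) i)) (x , α)
          × Consistent (t , not (lookup (xPath x Tu) i)) (x , not α)
          × ¬ HasCopy (sideTree x α Tu) (take (toℕ i) (xPath x Tu))
          × (∀ s → ¬ HasCopy (sideTree x α Tu)
                ((take (toℕ i) (xPath x Tu) ++ [ not (lookup (xPath x Tu) i) ]) ++ s))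
          × HasCopy (sideTree x (not α) Tu) (take (toℕ i) (xPath x Tu))
          × (∀ s → IsNode Tu ((take (toℕ i) (xPath x Tu) ++ [ not (lookup (xPath x Tu) i) ]) ++ s) →
                HasCopy (sideTree x (not α) Tu)
                  ((take (toℕ i) (xPath x Tu) ++ [ not (lookup (xPath x Tu) i) ]) ++ s))))
    -- (ii)
    × (∀ (t : Test n) → testAt Tu (xPath x Tu) ≡ just t →
        ∃[ b ] (¬ Consistent (t , b) (x , true)
          × ¬ Consistent (t , not b) (x , false)
          × ¬ HasCopy (sideTree x true Tu) (xPath x Tu)
          × (∀ s → ¬ HasCopy (sideTree x true Tu) ((xPath x Tu ++ [ b ]) ++ s))
          × ¬ HasCopy (sideTree x false Tu) (xPath x Tu)
          × (∀ s → ¬ HasCopy (sideTree x false Tu) ((xPath x Tu ++ [ not b ]) ++ s))))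
    -- (iii)
    × (∀ (z : Pos) → LeafAt Tu z → z ≢ xPath x Tu →
        ∃[ p ] (labelAt (splitAround x Tu) p ≡ just (just z)
          × (∀ p' → labelAt (splitAround x Tu) p' ≡ just (just z) → p' ≡ p)
          × (∀ q → (Reaches T u q × Reaches (splitAround x Tu) p q)
                   ⇔ (Reaches T u q × Reaches Tu z q))))
lemma2 I T _ irr u Tu eu x ax =
    (λ i t → sibling-deleted x Tu reach (take-lookup-drop (xPath x Tu) i))
  , (λ t → end-deleted x Tu reach x-splits)
  , λ z lf z≢ → let p , copy , unique , reaches = off-path-leaf x Tu x-splits reach z lf z≢
                in p , copy , unique , λ q → ⇔-refl ×-⇔ reaches q
  where
  reach = irreducible-reachable I T irr u eu
  x-splits = allowed-splits I x ax
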